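{- Let $R\models\mathrm{TPERF}_{p,\varpi}$ with truncated valuation $v:R\to\Gamma$. (1) Let $v^\flat:R^\flat\to\Gamma^\flat:=\varprojlim_{\gamma\mapsto p\gamma}\Gamma$ be the map induced by $v$, i.e. $v^\flat((x_i)_i)=(v(x_i))_i$. Then $(R^\flat,v^\flat)$ is a perfect valued ring of characteristic $p$ (i.e. $R^\flat$ is a perfect ring of characteristic $p$ and $v^\flat$ is a valuation on it). (2) The map $\iota:\Gamma\to\Gamma^\flat$ given by $\gamma\mapsto(p^{ -i}\gamma)_i$ for $\gamma\ne\infty$ and $\infty\mapsto\infty$ is well defined and strictly increasing. The image of $\Gamma\setminus\{\infty\}$ under $\iota$ is the initial segment $\{\delta\in\Gamma^\flat:\delta<p\,v(\varpi_1)\}$ of $\Gamma^\flat$. With $\varpi^\flat:=(0,\varpi_1,\varpi_2,\ldots)\in R^\flat$ and using this identification, $v^\flat(\varpi^\flat)=p\,v(\varpi_1)$. (3) The projection to the first coordinate $R^\flat\to R$ induces an isomorphism $R^\flat/(\varpi^\flat)\cong R$. (4) $R^\flat$ is a $\varpi^\flat$-adically complete and separated valuation ring.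
   Context: $\mathcal L_{\mathrm{div}}$ is the (discrete, first-order) language of rings with a binary predicate $x\mid y$. $\mathrm{TVR}$ is axiomatized by: ring axioms; $x\mid y$ iff $x$ divides $y$; for all $x,y$, $x\mid y$ or $y\mid x$; for all $x,y$, if $x\ne0$ and $x=yx$ then $y$ is a unit. For $R\models\mathrm{TVR}$, the truncated valuation $v:R\to\Gamma$ sends $a$ to the principal ideal $(a)$, where $\Gamma$ is the set of principal ideals ordered by reverse inclusion (so $v(x)\le v(y)$ iff $x\mid y$), a linearly ordered commutative monoid under ideal multiplication (written $+$), with least element $0=v(1)$ and greatest element $\infty=v(0)$; for $\gamma\le\delta\ne\infty$ there is a unique $\epsilon$ with $\gamma+\epsilon=\delta$, denoted $\delta-\gamma$, and $p^{ -i}\gamma$ denotes the unique (when it exists) element whose $p^i$-fold sum is $\gamma$. $\Gamma^\flat=\varprojlim_{\gamma\mapsto p\gamma}\Gamma$ is ordered coordinatewise, with $\infty=(\infty,\infty,\ldots)$. $\mathrm{TPERF}_p$ is $\mathrm{TVR}$ plus: $p=0$; $x\mapsto x^p$ is surjective; there is $\varpi\ne0$ with $\varpi^p=0$ such that $x^p=0$ implies $\varpi\mid x$ (a pseudo-uniformizer). $\mathrm{TPERF}_{p,\varpi}$ is the $\mathcal L_{\mathrm{div}}\cup\{\varpi_i:i\ge1\}$-theory $\mathrm{TPERF}_p$ plus "$\varpi_1$ is a pseudo-uniformizer" and $\varpi_{i+1}^p=\varpi_i$ for $i\ge1$. $R^\flat=\varprojlim_{x\mapsto x^p}R=\{(x_i)_{i\ge0}\in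 R^{\mathbb N}:x_{i+1}^p=x_i\}$ with coordinatewise ring operations (a ring since $R$ has characteristic $p$). -}

module Defs where

open import Level using (_⊔_)
open import Algebra.Bundles using (CommutativeRing)
open import Data.Nat using (ℕ; zero; suc)
import Data.Nat as N
open import Data.Product using (Σ; _×_; _,_)
open import Data.Sum using (_⊎_)
open import Relation.Nullary using (¬_)

module TPerf {c ℓ} (R : CommutativeRing c ℓ) where
  open CommutativeRing R

  infixr 8 _^_
  _^_ : Carrier → ℕ → Carrier
  x ^ zero = 1#
  x ^ suc n = x * (x ^ n)

  fromℕ : ℕ → Carrier
  fromℕ zero = 0#
  fromℕ (suc n) = 1# + fromℕ n

  _∣_ : Carrier → Carrier → Set (c ⊔ ℓ)
  x ∣ y = Σ Carrier (λ z → x * z ≈ y)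

  IsUnit : Carrier → Set (c ⊔ ℓ)
  IsUnit y = Σ Carrier (λ z → y * z ≈ 1#)

  record IsTVR : Set (c ⊔ ℓ) where
    field
      total : ∀ x y → x ∣ y ⊎ y ∣ x
      unit  : ∀ x y → ¬ (x ≈ 0#) → x ≈ y * x → IsUnit y

  IsPseudoUniformizer : ℕ → Carrier → Set (c ⊔ ℓ)
  IsPseudoUniformizer p w =
    ¬ (w ≈ 0#) × (w ^ p ≈ 0#) × (∀ x → x ^ p ≈ 0# → w ∣ x)

  record IsTPERF (p : ℕ) : Set (c ⊔ ℓ) where
    field
      tvr      : IsTVR
      charP    : fromℕ p ≈ 0#
      frobSurj : ∀ x → Σ Carrier (λ y → y ^ p ≈ x)
      pseudoUniformizer : Σ Carrier (IsPseudoUniformizer p)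

  -- R ⊨ TPERF_{p,ϖ}; the constant ϖ_i (i ≥ 1) is ϖ i, the value ϖ 0 is unused.
  record IsTPERFϖ (p : ℕ) (ϖ : ℕ → Carrier) : Set (c ⊔ ℓ) where
    field
      tperf  : IsTPERF p
      ϖ₁-pu  : IsPseudoUniformizer p (ϖ 1)
      ϖ-root : ∀ i → ϖ (suc (suc i)) ^ p ≈ ϖ (suc i)

  -- Γ: principal ideals, represented by generators up to association.
  -- v(x) is represented by x itself; v(x) ≤ v(y) iff x ∣ y;
  -- addition in Γ is multiplication of generators; 0 = v(1), ∞ = v(0).
  Γ : Set c
  Γ = Carrier

  v : Carrier → Γ
  v x = x

  _≈Γ_ : Γ → Γ → Set (c ⊔ ℓ)
  γ ≈Γ δ = (γ ∣ δ) × (δ ∣ γ)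

  _≤Γ_ : Γ → Γ → Set (c ⊔ ℓ)
  γ ≤Γ δ = γ ∣ δ

  _<Γ_ : Γ → Γ → Set (c ⊔ ℓ)
  γ <Γ δ = (γ ≤Γ δ) × ¬ (γ ≈Γ δ)

  ∞Γ : Γ
  ∞Γ = 0#

  _·Γ_ : ℕ → Γ → Γ
  n ·Γ γ = γ ^ n

  Seq : Set c
  Seq = ℕ → Carrier

  module Flat (p : ℕ) where

    -- x ∈ R^♭ = lim_{x ↦ x^p} R
    IsFlat : Seq → Set ℓ
    IsFlat x = ∀ i → x (suc i) ^ p ≈ x i

    _≈♭_ : Seq → Seq → Set ℓ
    x ≈♭ y = ∀ i → x i ≈ y i

    _+♭_ _*♭_ : Seq → Seq → Seq
    (x +♭ y) i = x i + y i
    (x *♭ y) i = x i * y i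

    -♭_ : Seq → Seq
    (-♭ x) i = - (x i)

    _-♭_ : Seq → Seq → Seq
    x -♭ y = x +♭ (-♭ y)

    0♭ 1♭ : Seq
    0♭ i = 0#
    1♭ i = 1#

    fromℕ♭ : ℕ → Seq
    fromℕ♭ n i = fromℕ n

    _^♭_ : Seq → ℕ → Seq
    (x ^♭ n) i = x i ^ n

    _∣♭_ : Seq → Seq → Set (c ⊔ ℓ)
    x ∣♭ y = Σ Seq (λ z → IsFlat z × (x *♭ z) ≈♭ y)

    -- δ ∈ Γ^♭ = lim_{γ ↦ pγ} Γ
    IsΓFlat : Seq → Set (c ⊔ ℓ)
    IsΓFlat δ = ∀ i → (p ·Γ δ (suc i)) ≈Γ δ i

    _≈Γ♭_ : Seq → Seq → Set (c ⊔ ℓ)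
    δ ≈Γ♭ ε = ∀ i → δ i ≈Γ ε i

    _≤Γ♭_ : Seq → Seq → Set (c ⊔ ℓ)
    δ ≤Γ♭ ε = ∀ i → δ i ≤Γ ε i

    _<Γ♭_ : Seq → Seq → Set (c ⊔ ℓ)
    δ <Γ♭ ε = (δ ≤Γ♭ ε) × ¬ (δ ≈Γ♭ ε)

    _+Γ♭_ : Seq → Seq → Seq
    (δ +Γ♭ ε) i = δ i * ε i

    _·Γ♭_ : ℕ → Seq → Seq
    (n ·Γ♭ δ) i = n ·Γ δ i

    0Γ♭ ∞Γ♭ : Seq
    0Γ♭ i = 1#
    ∞Γ♭ i = ∞Γ

    v♭ : Seq → Seq
    v♭ x i = v (x i)

    ϖ♭ : (ℕ → Carrier) → Seq
    ϖ♭ ϖ zero = 0#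
    ϖ♭ ϖ (suc i) = ϖ (suc i)

    record Part1 : Set (c ⊔ ℓ) where
      field
        flat-0 : IsFlat 0♭
        flat-1 : IsFlat 1♭
        flat-+ : ∀ x y → IsFlat x → IsFlat y → IsFlat (x +♭ y)
        flat-* : ∀ x y → IsFlat x → IsFlat y → IsFlat (x *♭ y)
        flat-- : ∀ x → IsFlat x → IsFlat (-♭ x)
        char♭ : fromℕ♭ p ≈♭ 0♭
        frob♭-surj : ∀ x → IsFlat x → Σ Seq (λ y → IsFlat y × (y ^♭ p) ≈♭ x)
        frob♭-inj  : ∀ x y → IsFlat x → IsFlat y → (x ^♭ p) ≈♭ (y ^♭ p) → x ≈♭ y
        v♭-flat  : ∀ x → IsFlat x → IsΓFlat (v♭ x)
        Γ♭-total : ∀ δ ε → IsΓFlat δ → IsΓFlat ε → δ ≤Γ♭ ε ⊎ ε ≤Γ♭ δ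
        domain   : ∀ x y → IsFlat x → IsFlat y → (x *♭ y) ≈♭ 0♭ → x ≈♭ 0♭ ⊎ y ≈♭ 0♭
        nontriv  : ¬ (1♭ ≈♭ 0♭)
        v♭-one   : v♭ 1♭ ≈Γ♭ 0Γ♭
        v♭-∞     : ∀ x → IsFlat x → (v♭ x ≈Γ♭ ∞Γ♭ → x ≈♭ 0♭) × (x ≈♭ 0♭ → v♭ x ≈Γ♭ ∞Γ♭)
        v♭-mul   : ∀ x y → IsFlat x → IsFlat y → v♭ (x *♭ y) ≈Γ♭ (v♭ x +Γ♭ v♭ y)
        v♭-add   : ∀ x y → IsFlat x → IsFlat y →
                   v♭ x ≤Γ♭ v♭ (x +♭ y) ⊎ v♭ y ≤Γ♭ v♭ (x +♭ y)

    record Part2 (ϖ : ℕ → Carrier) (ι : Γ → Seq) : Set (c ⊔ ℓ) where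
      field
        root-unique : ∀ γ i δ δ' → ¬ (γ ≈Γ ∞Γ) →
                      ((p N.^ i) ·Γ δ) ≈Γ γ → ((p N.^ i) ·Γ δ') ≈Γ γ → δ ≈Γ δ'
        ι-root  : ∀ γ → ¬ (γ ≈Γ ∞Γ) → ∀ i → ((p N.^ i) ·Γ ι γ i) ≈Γ γ
        ι-∞     : ∀ γ → γ ≈Γ ∞Γ → ι γ ≈Γ♭ ∞Γ♭
        ι-flat  : ∀ γ → IsΓFlat (ι γ)
        ι-resp  : ∀ γ γ' → γ ≈Γ γ' → ι γ ≈Γ♭ ι γ'
        ι-strict : ∀ γ γ' → γ <Γ γ' → ι γ <Γ♭ ι γ'
        ι-image : ∀ δ → IsΓFlat δ →
                  (δ <Γ♭ (p ·Γ♭ ι (v (ϖ 1))) →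
                     Σ Γ (λ γ → ¬ (γ ≈Γ ∞Γ) × ι γ ≈Γ♭ δ))
                  × (Σ Γ (λ γ → ¬ (γ ≈Γ ∞Γ) × ι γ ≈Γ♭ δ) →
                     δ <Γ♭ (p ·Γ♭ ι (v (ϖ 1))))
        ϖ♭-flat : IsFlat (ϖ♭ ϖ)
        v♭-ϖ♭   : v♭ (ϖ♭ ϖ) ≈Γ♭ (p ·Γ♭ ι (v (ϖ 1)))

    -- (3) projection to coordinate 0 induces R^♭/(ϖ^♭) ≅ R
    --     (it is a ring map by definition of the coordinatewise operations)
    record Part3 (ϖ : ℕ → Carrier) : Set (c ⊔ ℓ) where
      field
        pr₀-surj : ∀ a → Σ Seq (λ x → IsFlat x × x 0 ≈ a)
        pr₀-ker  : ∀ x → IsFlat x → (x 0 ≈ 0# → ϖ♭ ϖ ∣♭ x) × (ϖ♭ ϖ ∣♭ x → x 0 ≈ 0#)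

    record Part4 (ϖ : ℕ → Carrier) : Set (c ⊔ ℓ) where
      field
        domain   : ∀ x y → IsFlat x → IsFlat y → (x *♭ y) ≈♭ 0♭ → x ≈♭ 0♭ ⊎ y ≈♭ 0♭
        nontriv  : ¬ (1♭ ≈♭ 0♭)
        val-ring : ∀ x y → IsFlat x → IsFlat y → x ∣♭ y ⊎ y ∣♭ x
        separated : ∀ x → IsFlat x → (∀ n → (ϖ♭ ϖ ^♭ n) ∣♭ x) → x ≈♭ 0♭
        complete : ∀ (s : ℕ → Seq) → (∀ n → IsFlat (s n)) →
                   (∀ n → (ϖ♭ ϖ ^♭ n) ∣♭ (s (suc n) -♭ s n)) →
                   Σ Seq (λ x → IsFlat x × (∀ n → (ϖ♭ ϖ ^♭ n) ∣♭ (x -♭ s n)))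

{-# OPTIONS --safe #-}
-- Since p is prime and p = 0 in R, Frobenius is a ring endomorphism (p divides C(p,k) for 0 < k < p),
-- so R^♭ is a subring of R^ℕ on which Frobenius is bijective.  The valuation theory rests on one
-- consequence of the unit axiom of TVR: xⁿ ∣ yⁿ with xⁿ ≠ 0 forces x ∣ y.  Hence a divisibility between
-- two elements of Γ^♭ at a single coordinate where the smaller one is finite holds at every coordinate;
-- totality of Γ^♭, the properties of ι and of its image, v^♭(ϖ^♭) and the kernel of the first projection
-- all follow from this.  Divisibility in R^♭ can be checked coordinatewise: the coordinatewise quotients
-- are coherent up to square-zero errors, which large p-power Frobenius kills.  Finally the i-th coordinate
-- of ϖ^♭ is nilpotent of order p^i, so a ϖ^♭-adic Cauchy sequence is eventually constant in each coordinate.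
module Submission where

open import Defs
open import Level using (_⊔_; Lift; lift; lower)
open import Algebra.Bundles using (CommutativeRing)
open import Axiom.ExcludedMiddle using (ExcludedMiddle)
open import Data.Nat as ℕ using (ℕ; zero; suc; _≤_; _<_; z≤n; s≤s; NonZero)
import Data.Nat.Properties as ℕ
open import Data.Nat.Combinatorics using (_C_; nC1≡n; nCn≡1; k>n⇒nCk≡0; nCk+nC[k+1]≡[n+1]C[k+1])
open import Data.Nat.Divisibility using (divides; ∣⇒≤) renaming (_∣_ to _∣ℕ_)
open import Data.Nat.Primality using (Prime; euclidsLemma; ¬prime[0]; prime⇒nonZero; prime⇒nonTrivial)
open import Data.Fin as Fin using (Fin; toℕ)
open import Data.Fin.Properties using (toℕ-fromℕ)
open import Data.Product using (Σ; ∃; _×_; _,_; proj₁; proj₂)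
open import Data.Sum using (_⊎_; inj₁; inj₂; fromInj₂)
open import Function using (_∘_)
open import Relation.Nullary using (¬_; contradiction; yes; no)
open import Relation.Nullary.Decidable using (map′; decidable-stable; toSum)
open import Relation.Binary.PropositionalEquality as ≡ using (_≡_)

[1+k]*[1+n]C[1+k]≡[1+n]*nCk : ∀ n k → suc k ℕ.* (suc n C suc k) ≡ suc n ℕ.* (n C k)
[1+k]*[1+n]C[1+k]≡[1+n]*nCk zero zero = ≡.refl
[1+k]*[1+n]C[1+k]≡[1+n]*nCk zero (suc k) = begin
  suc (suc k) ℕ.* (1 C suc (suc k))
    ≡⟨ ≡.cong (suc (suc k) ℕ.*_) (k>n⇒nCk≡0 {1} {suc (suc k)} (s≤s (s≤s z≤n))) ⟩
  suc (suc k) ℕ.* 0                 ≡⟨ ℕ.*-zeroʳ (suc (suc k)) ⟩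
  0                                 ≡⟨ ≡.cong (1 ℕ.*_) (k>n⇒nCk≡0 {0} {suc k} (s≤s z≤n)) ⟨
  1 ℕ.* (0 C suc k)                 ∎
  where open ≡.≡-Reasoning
[1+k]*[1+n]C[1+k]≡[1+n]*nCk (suc n) zero = begin
  1 ℕ.* (suc (suc n) C 1) ≡⟨ ℕ.*-identityˡ _ ⟩
  suc (suc n) C 1         ≡⟨ nC1≡n (suc (suc n)) ⟩
  suc (suc n)             ≡⟨ ℕ.*-identityʳ (suc (suc n)) ⟨
  suc (suc n) ℕ.* 1       ∎
  where open ≡.≡-Reasoning
[1+k]*[1+n]C[1+k]≡[1+n]*nCk (suc n) (suc k) = begin
  suc (suc k) ℕ.* (suc (suc n) C suc (suc k))
    ≡⟨ ≡.cong (suc (suc k) ℕ.*_) (nCk+nC[k+1]≡[n+1]C[k+1] (suc n) (suc k)) ⟨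
  suc (suc k) ℕ.* (a ℕ.+ suc n C suc (suc k))
    ≡⟨ ℕ.*-distribˡ-+ (suc (suc k)) a _ ⟩
  (a ℕ.+ suc k ℕ.* a) ℕ.+ suc (suc k) ℕ.* (suc n C suc (suc k))
    ≡⟨ ≡.cong₂ (λ u v → (a ℕ.+ u) ℕ.+ v)
         ([1+k]*[1+n]C[1+k]≡[1+n]*nCk n k) ([1+k]*[1+n]C[1+k]≡[1+n]*nCk n (suc k)) ⟩
  (a ℕ.+ suc n ℕ.* (n C k)) ℕ.+ suc n ℕ.* (n C suc k)
    ≡⟨ ℕ.+-assoc a _ _ ⟩
  a ℕ.+ (suc n ℕ.* (n C k) ℕ.+ suc n ℕ.* (n C suc k))
    ≡⟨ ≡.cong (a ℕ.+_) (ℕ.*-distribˡ-+ (suc n) (n C k) (n C suc k)) ⟨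
  a ℕ.+ suc n ℕ.* (n C k ℕ.+ n C suc k)
    ≡⟨ ≡.cong (λ u → a ℕ.+ suc n ℕ.* u) (nCk+nC[k+1]≡[n+1]C[k+1] n k) ⟩
  a ℕ.+ suc n ℕ.* a
    ∎
  where
  open ≡.≡-Reasoning
  a : ℕ
  a = suc n C suc k

prime∣pCk : ∀ {p k} → Prime p → 0 < k → k < p → p ∣ℕ p C k
prime∣pCk {zero} p-prime = contradiction p-prime ¬prime[0]
prime∣pCk {suc n} {suc k} p-prime _ k<p
  with euclidsLemma (suc k) (suc n C suc k) p-prime
         (divides (n C k) (≡.trans ([1+k]*[1+n]C[1+k]≡[1+n]*nCk n k) (ℕ.*-comm (suc n) (n C k))))
... | inj₁ p∣k = contradiction (∣⇒≤ p∣k) (ℕ.<⇒≱ k<p)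
... | inj₂ p∣C = p∣C

module _ {c ℓ} (R : CommutativeRing c ℓ) where
  open CommutativeRing R hiding (zero)
  open TPerf R
  open import Relation.Binary.Reasoning.Setoid setoid
  open import Algebra.Properties.Ring ring using (x[y-z]≈xy-xz; x∙y⁻¹≈ε⇒x≈y; +-inverseʳ-unique)
  open import Algebra.Properties.CommutativeSemigroup *-commutativeSemigroup
    using (interchange; xy∙z≈xz∙y; xy∙z≈zy∙x)
  open import Algebra.Properties.Semiring.Mult semiring using (×-assocˡ; ×-congʳ) renaming (_×_ to _×ₘ_)
  open import Algebra.Properties.Monoid.Sum +-monoid using (sum)
  import Algebra.Properties.Semiring.Exp semiring as Exp
  import Algebra.Properties.CommutativeSemiring.Binomial commutativeSemiring as Binomial

  ^-congˡ : ∀ n {x y} → x ≈ y → x ^ n ≈ y ^ n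
  ^-congˡ zero    x≈y = refl
  ^-congˡ (suc n) x≈y = *-cong x≈y (^-congˡ n x≈y)

  ^-homo-* : ∀ x m n → x ^ (m ℕ.+ n) ≈ x ^ m * x ^ n
  ^-homo-* x zero    n = sym (*-identityˡ _)
  ^-homo-* x (suc m) n = trans (*-congˡ (^-homo-* x m n)) (sym (*-assoc _ _ _))

  ^-distrib-* : ∀ x y n → (x * y) ^ n ≈ x ^ n * y ^ n
  ^-distrib-* x y zero    = sym (*-identityˡ 1#)
  ^-distrib-* x y (suc n) = begin
    (x * y) * (x * y) ^ n       ≈⟨ *-congˡ (^-distrib-* x y n) ⟩
    (x * y) * (x ^ n * y ^ n)   ≈⟨ interchange x y (x ^ n) (y ^ n) ⟩
    (x * x ^ n) * (y * y ^ n)   ∎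

  1^n≈1 : ∀ n → 1# ^ n ≈ 1#
  1^n≈1 zero    = refl
  1^n≈1 (suc n) = trans (*-identityˡ _) (1^n≈1 n)

  0^n≈0 : ∀ n .{{_ : NonZero n}} → 0# ^ n ≈ 0#
  0^n≈0 (suc n) = zeroˡ _

  ^-assocʳ : ∀ x m n → (x ^ m) ^ n ≈ x ^ (m ℕ.* n)
  ^-assocʳ x zero    n = 1^n≈1 n
  ^-assocʳ x (suc m) n = begin
    (x * x ^ m) ^ n         ≈⟨ ^-distrib-* x (x ^ m) n ⟩
    x ^ n * (x ^ m) ^ n     ≈⟨ *-congˡ (^-assocʳ x m n) ⟩
    x ^ n * x ^ (m ℕ.* n)   ≈⟨ ^-homo-* x n (m ℕ.* n) ⟨
    x ^ (n ℕ.+ m ℕ.* n)     ∎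

  ^-^-comm : ∀ x m n → (x ^ m) ^ n ≈ (x ^ n) ^ m
  ^-^-comm x m n = begin
    (x ^ m) ^ n       ≈⟨ ^-assocʳ x m n ⟩
    x ^ (m ℕ.* n)     ≡⟨ ≡.cong (x ^_) (ℕ.*-comm m n) ⟩
    x ^ (n ℕ.* m)     ≈⟨ ^-assocʳ x n m ⟨
    (x ^ n) ^ m       ∎

  square≈0⇒^≈0 : ∀ {x} n → x * x ≈ 0# → 2 ≤ n → x ^ n ≈ 0#
  square≈0⇒^≈0 (suc zero) _ (s≤s ())
  square≈0⇒^≈0 {x} (suc (suc n)) x²≈0 _ = begin
    x * (x * x ^ n)   ≈⟨ *-assoc x x (x ^ n) ⟨
    (x * x) * x ^ n   ≈⟨ *-congʳ x²≈0 ⟩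
    0# * x ^ n        ≈⟨ zeroˡ _ ⟩
    0#                ∎

  ∣-reflexive : ∀ {x y} → x ≈ y → x ∣ y
  ∣-reflexive x≈y = 1# , trans (*-identityʳ _) x≈y

  ∣-refl : ∀ {x} → x ∣ x
  ∣-refl = ∣-reflexive refl

  ∣-trans : ∀ {x y z} → x ∣ y → y ∣ z → x ∣ z
  ∣-trans {x} (a , xa≈y) (b , yb≈z) = a * b , trans (sym (*-assoc x a b)) (trans (*-congʳ xa≈y) yb≈z)

  ∣-respʳ : ∀ {x y z} → y ≈ z → x ∣ y → x ∣ z
  ∣-respʳ y≈z x∣y = ∣-trans x∣y (∣-reflexive y≈z)

  ∣-respˡ : ∀ {x y z} → x ≈ y → x ∣ z → y ∣ z
  ∣-respˡ x≈y x∣z = ∣-trans (∣-reflexive (sym x≈y)) x∣z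

  x∣y∧y≉0⇒x≉0 : ∀ {x y} → x ∣ y → ¬ y ≈ 0# → ¬ x ≈ 0#
  x∣y∧y≉0⇒x≉0 (a , xa≈y) y≉0 x≈0 = y≉0 (trans (sym xa≈y) (trans (*-congʳ x≈0) (zeroˡ a)))

  ≈Γ-≉0 : ∀ {x y} → x ≈Γ y → ¬ y ≈ 0# → ¬ x ≈ 0#
  ≈Γ-≉0 (x∣y , _) = x∣y∧y≉0⇒x≉0 x∣y

  x∣0 : ∀ x → x ∣ 0#
  x∣0 x = 0# , zeroʳ x

  0∣x⇒x≈0 : ∀ {x} → 0# ∣ x → x ≈ 0#
  0∣x⇒x≈0 (a , 0a≈x) = trans (sym 0a≈x) (zeroˡ a)

  ∣-^ : ∀ n {x y} → x ∣ y → (x ^ n) ∣ (y ^ n)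
  ∣-^ n {x} (a , xa≈y) = a ^ n , trans (sym (^-distrib-* x a n)) (^-congˡ n xa≈y)

  ∣-+ : ∀ {x y z} → x ∣ y → x ∣ z → x ∣ (y + z)
  ∣-+ {x} (a , xa≈y) (b , xb≈z) = a + b , trans (distribˡ x a b) (+-cong xa≈y xb≈z)

  ^∣^+ : ∀ x k m → (x ^ m) ∣ (x ^ (k ℕ.+ m))
  ^∣^+ x k m = x ^ k , trans (*-comm _ _) (sym (^-homo-* x k m))

  ≈Γ-refl : ∀ {x} → x ≈Γ x
  ≈Γ-refl = ∣-refl , ∣-refl

  ≈Γ-sym : ∀ {x y} → x ≈Γ y → y ≈Γ x
  ≈Γ-sym (x∣y , y∣x) = y∣x , x∣y

  ≈Γ-trans : ∀ {x y z} → x ≈Γ y → y ≈Γ z → x ≈Γ z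
  ≈Γ-trans (x∣y , y∣x) (y∣z , z∣y) = ∣-trans x∣y y∣z , ∣-trans z∣y y∣x

  ≈⇒≈Γ : ∀ {x y} → x ≈ y → x ≈Γ y
  ≈⇒≈Γ x≈y = ∣-reflexive x≈y , ∣-reflexive (sym x≈y)

  ≈Γ-^ : ∀ n {x y} → x ≈Γ y → (x ^ n) ≈Γ (y ^ n)
  ≈Γ-^ n (x∣y , y∣x) = ∣-^ n x∣y , ∣-^ n y∣x

  ≈Γ∞⇒≈0 : ∀ {x} → x ≈Γ ∞Γ → x ≈ 0#
  ≈Γ∞⇒≈0 (_ , 0∣x) = 0∣x⇒x≈0 0∣x

  ≉Γ∞⇒≉0 : ∀ {x} → ¬ x ≈Γ ∞Γ → ¬ x ≈ 0#
  ≉Γ∞⇒≉0 x≉∞ x≈0 = x≉∞ (≈⇒≈Γ x≈0)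

  ∣-respΓˡ : ∀ {x y z} → x ≈Γ y → x ∣ z → y ∣ z
  ∣-respΓˡ (_ , y∣x) x∣z = ∣-trans y∣x x∣z

  ∣-respΓʳ : ∀ {x y z} → y ≈Γ z → x ∣ y → x ∣ z
  ∣-respΓʳ (y∣z , _) x∣y = ∣-trans x∣y y∣z

  ^≡Exp^ : ∀ x n → x ^ n ≡ x Exp.^ n
  ^≡Exp^ x zero    = ≡.refl
  ^≡Exp^ x (suc n) = ≡.cong (x *_) (^≡Exp^ x n)

  ×≈fromℕ* : ∀ m x → m ×ₘ x ≈ fromℕ m * x
  ×≈fromℕ* zero    x = sym (zeroˡ x)
  ×≈fromℕ* (suc m) x = begin
    x + m ×ₘ x              ≈⟨ +-cong (sym (*-identityˡ x)) (×≈fromℕ* m x) ⟩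
    1# * x + fromℕ m * x    ≈⟨ distribʳ x 1# (fromℕ m) ⟨
    (1# + fromℕ m) * x      ∎

  sum≈last : ∀ m (u : Fin (suc m) → Carrier) → (∀ i → toℕ i < m → u i ≈ 0#) → sum u ≈ u (Fin.fromℕ m)
  sum≈last zero    u _      = +-identityʳ _
  sum≈last (suc m) u init≈0 = begin
    u Fin.zero + sum (u ∘ Fin.suc)
      ≈⟨ +-cong (init≈0 Fin.zero (s≤s z≤n))
                (sum≈last m (u ∘ Fin.suc) (λ i i<m → init≈0 (Fin.suc i) (s≤s i<m))) ⟩
    0# + u (Fin.fromℕ (suc m))      ≈⟨ +-identityˡ _ ⟩
    u (Fin.fromℕ (suc m))           ∎

  freshmans-dream : ∀ {p} → Prime p → fromℕ p ≈ 0# → ∀ x y → (x + y) ^ p ≈ x ^ p + y ^ p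
  freshmans-dream {zero} p-prime = contradiction p-prime ¬prime[0]
  freshmans-dream {suc n} p-prime char-p x y = begin
    (x + y) ^ suc n                            ≡⟨ ^≡Exp^ (x + y) (suc n) ⟩
    (x + y) Exp.^ suc n                        ≈⟨ Binomial.theorem (suc n) x y ⟩
    term Fin.zero + sum (term ∘ Fin.suc)       ≈⟨ +-cong first (sum≈last n (term ∘ Fin.suc) middle≈0) ⟩
    y ^ suc n + term (Fin.suc (Fin.fromℕ n))   ≈⟨ +-congˡ (last (toℕ-fromℕ n)) ⟩
    y ^ suc n + x ^ suc n                      ≈⟨ +-comm _ _ ⟩
    x ^ suc n + y ^ suc n                      ∎
    where
    term : Fin (suc (suc n)) → Carrier
    term = Binomial.binomialTerm x y (suc n)

    p∣m⇒m×≈0 : ∀ {m} z → suc n ∣ℕ m → m ×ₘ z ≈ 0#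
    p∣m⇒m×≈0 z (divides q ≡.refl) = begin
      (q ℕ.* suc n) ×ₘ z     ≈⟨ ×-assocˡ z q (suc n) ⟨
      q ×ₘ (suc n ×ₘ z)      ≈⟨ ×-congʳ q (trans (×≈fromℕ* (suc n) z) (trans (*-congʳ char-p) (zeroˡ z))) ⟩
      q ×ₘ 0#                ≈⟨ ×≈fromℕ* q 0# ⟩
      fromℕ q * 0#           ≈⟨ zeroʳ _ ⟩
      0#                     ∎

    middle≈0 : ∀ i → toℕ i < n → term (Fin.suc i) ≈ 0#
    middle≈0 i i<n = p∣m⇒m×≈0 _ (prime∣pCk p-prime (s≤s z≤n) (s≤s i<n))

    first : term Fin.zero ≈ y ^ suc n
    first = begin
      1# * y Exp.^ suc n + 0#   ≈⟨ +-identityʳ _ ⟩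
      1# * y Exp.^ suc n        ≈⟨ *-identityˡ _ ⟩
      y Exp.^ suc n             ≡⟨ ^≡Exp^ y (suc n) ⟨
      y ^ suc n                 ∎

    -- toℕ (Fin.fromℕ n) is only propositionally equal to n.
    last : ∀ {j} → j ≡ n → (suc n C suc j) ×ₘ (x Exp.^ suc j * y Exp.^ (n ℕ.∸ j)) ≈ x ^ suc n
    last ≡.refl = begin
      (suc n C suc n) ×ₘ (x Exp.^ suc n * y Exp.^ (n ℕ.∸ n))
        ≡⟨ ≡.cong₂ (λ a b → a ×ₘ (x Exp.^ suc n * y Exp.^ b)) (nCn≡1 (suc n)) (ℕ.n∸n≡0 n) ⟩
      x Exp.^ suc n * 1# + 0#   ≈⟨ +-identityʳ _ ⟩
      x Exp.^ suc n * 1#        ≈⟨ *-identityʳ _ ⟩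
      x Exp.^ suc n             ≡⟨ ^≡Exp^ x (suc n) ⟨
      x ^ suc n                 ∎

  module Frobenius {p} (p-prime : Prime p) (char-p : fromℕ p ≈ 0#) where
    private instance
      p≢0 : NonZero p
      p≢0 = prime⇒nonZero p-prime

    frobenius-+ : ∀ x y → (x + y) ^ p ≈ x ^ p + y ^ p
    frobenius-+ = freshmans-dream p-prime char-p

    frobenius-‿ : ∀ x → (- x) ^ p ≈ - (x ^ p)
    frobenius-‿ x = +-inverseʳ-unique (x ^ p) ((- x) ^ p) (begin
      x ^ p + (- x) ^ p   ≈⟨ frobenius-+ x (- x) ⟨
      (x - x) ^ p         ≈⟨ ^-congˡ p (-‿inverseʳ x) ⟩
      0# ^ p              ≈⟨ 0^n≈0 p ⟩
      0#                  ∎)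

    frobenius-sub : ∀ x y → (x - y) ^ p ≈ x ^ p - y ^ p
    frobenius-sub x y = trans (frobenius-+ x (- y)) (+-congˡ (frobenius-‿ y))

    frobenius-iterate-sub : ∀ k x y → (x - y) ^ (p ℕ.^ k) ≈ x ^ (p ℕ.^ k) - y ^ (p ℕ.^ k)
    frobenius-iterate-sub zero    x y =
      trans (*-identityʳ _) (sym (+-cong (*-identityʳ x) (-‿cong (*-identityʳ y))))
    frobenius-iterate-sub (suc k) x y = begin
      (x - y) ^ (p ℕ.* q)               ≈⟨ ^-assocʳ (x - y) p q ⟨
      ((x - y) ^ p) ^ q                 ≈⟨ ^-congˡ q (frobenius-sub x y) ⟩
      (x ^ p - y ^ p) ^ q               ≈⟨ frobenius-iterate-sub k (x ^ p) (y ^ p) ⟩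
      (x ^ p) ^ q - (y ^ p) ^ q         ≈⟨ +-cong (^-assocʳ x p q) (-‿cong (^-assocʳ y p q)) ⟩
      x ^ (p ℕ.* q) - y ^ (p ℕ.* q)     ∎
      where
      q : ℕ
      q = p ℕ.^ k

  module ValuationRing (tvr : IsTVR) where
    open IsTVR tvr

    *≈0⇒square≈0 : ∀ {x y} → x * y ≈ 0# → x * x ≈ 0# ⊎ y * y ≈ 0#
    *≈0⇒square≈0 {x} {y} xy≈0 with total x y
    ... | inj₁ (a , xa≈y) = inj₂ (begin
      y * y         ≈⟨ *-congʳ xa≈y ⟨
      (x * a) * y   ≈⟨ xy∙z≈xz∙y x a y ⟩
      (x * y) * a   ≈⟨ *-congʳ xy≈0 ⟩
      0# * a        ≈⟨ zeroˡ a ⟩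
      0#            ∎)
    ... | inj₂ (a , ya≈x) = inj₁ (begin
      x * x         ≈⟨ *-congˡ ya≈x ⟨
      x * (y * a)   ≈⟨ *-assoc x y a ⟨
      (x * y) * a   ≈⟨ *-congʳ xy≈0 ⟩
      0# * a        ≈⟨ zeroˡ a ⟩
      0#            ∎)

    -- If x = y u and yⁿ = xⁿ w then xⁿ = (uⁿ w) xⁿ, so uⁿ w is a unit by the unit axiom of TVR,
    -- hence so is u.
    ^-reflects-∣ : ∀ n .{{_ : NonZero n}} {x y} → ¬ x ^ n ≈ 0# → (x ^ n) ∣ (y ^ n) → x ∣ y
    ^-reflects-∣ (suc n) {x} {y} xⁿ≉0 (w , xⁿw≈yⁿ) with total x y
    ... | inj₁ x∣y = x∣y
    ... | inj₂ (u , yu≈x) = (u ^ n * w) * s , (begin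
      x * ((u ^ n * w) * s)        ≈⟨ *-congʳ yu≈x ⟨
      (y * u) * ((u ^ n * w) * s)  ≈⟨ *-assoc y u _ ⟩
      y * (u * ((u ^ n * w) * s))
        ≈⟨ *-congˡ (trans (*-congʳ (*-assoc u (u ^ n) w)) (*-assoc u (u ^ n * w) s)) ⟨
      y * ((u ^ suc n * w) * s)    ≈⟨ *-congˡ uᴺws≈1 ⟩
      y * 1#                       ≈⟨ *-identityʳ y ⟩
      y                            ∎)
      where
      N : ℕ
      N = suc n
      xᴺ≈uᴺwxᴺ : x ^ N ≈ (u ^ N * w) * x ^ N
      xᴺ≈uᴺwxᴺ = begin
        x ^ N               ≈⟨ ^-congˡ N yu≈x ⟨
        (y * u) ^ N         ≈⟨ ^-distrib-* y u N ⟩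
        y ^ N * u ^ N       ≈⟨ *-congʳ xⁿw≈yⁿ ⟨
        (x ^ N * w) * u ^ N ≈⟨ xy∙z≈zy∙x (x ^ N) w (u ^ N) ⟩
        (u ^ N * w) * x ^ N ∎
      uᴺw-unit : IsUnit (u ^ N * w)
      uᴺw-unit = unit (x ^ N) (u ^ N * w) xⁿ≉0 xᴺ≈uᴺwxᴺ
      s : Carrier
      s = proj₁ uᴺw-unit
      uᴺws≈1 : (u ^ N * w) * s ≈ 1#
      uᴺws≈1 = proj₂ uᴺw-unit

    ^-injectiveΓ : ∀ n .{{_ : NonZero n}} {x y} → ¬ x ^ n ≈ 0# → (x ^ n) ≈Γ (y ^ n) → x ≈Γ y
    ^-injectiveΓ n xⁿ≉0 (xⁿ∣yⁿ , yⁿ∣xⁿ) =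
      ^-reflects-∣ n xⁿ≉0 xⁿ∣yⁿ , ^-reflects-∣ n (x∣y∧y≉0⇒x≉0 yⁿ∣xⁿ xⁿ≉0) yⁿ∣xⁿ

  [x-y]+[y-z]≈x-z : ∀ x y z → (x - y) + (y - z) ≈ x - z
  [x-y]+[y-z]≈x-z x y z = begin
    (x - y) + (y - z)       ≈⟨ +-assoc x (- y) (y - z) ⟩
    x + (- y + (y - z))     ≈⟨ +-congˡ (+-assoc (- y) y (- z)) ⟨
    x + ((- y + y) - z)     ≈⟨ +-congˡ (+-congʳ (-‿inverseˡ y)) ⟩
    x + (0# - z)            ≈⟨ +-congˡ (+-identityˡ (- z)) ⟩
    x - z                   ∎

  module Cauchy {a : Carrier} {t : ℕ → Carrier} (cauchy : ∀ n → (a ^ n) ∣ (t (suc n) - t n)) where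

    cauchy-∣ : ∀ k m → (a ^ m) ∣ (t (k ℕ.+ m) - t m)
    cauchy-∣ zero    m = ∣-respʳ (sym (-‿inverseʳ (t m))) (x∣0 _)
    cauchy-∣ (suc k) m = ∣-respʳ ([x-y]+[y-z]≈x-z _ _ _)
      (∣-+ (∣-trans (^∣^+ a k m) (cauchy (k ℕ.+ m))) (cauchy-∣ k m))

    cauchy-stable : ∀ {N n} → a ^ N ≈ 0# → N ≤ n → t n ≈ t N
    cauchy-stable {N} aᴺ≈0 N≤n = ≡.subst (λ j → t j ≈ t N) (ℕ.m∸n+n≡m N≤n)
      (x∙y⁻¹≈ε⇒x≈y _ _ (0∣x⇒x≈0 (∣-respˡ aᴺ≈0 (cauchy-∣ _ N))))

  module Sequences (p : ℕ) where
    open Flat p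

    iterate : ∀ {x} → IsFlat x → ∀ i k → x (i ℕ.+ k) ^ (p ℕ.^ k) ≈ x i
    iterate     x♭ zero    zero    = *-identityʳ _
    iterate {x} x♭ zero    (suc k) = begin
      x (suc k) ^ (p ℕ.* p ℕ.^ k)     ≈⟨ ^-assocʳ _ p (p ℕ.^ k) ⟨
      (x (suc k) ^ p) ^ (p ℕ.^ k)     ≈⟨ ^-congˡ (p ℕ.^ k) (x♭ k) ⟩
      x k ^ (p ℕ.^ k)                 ≈⟨ iterate x♭ zero k ⟩
      x zero                          ∎
    iterate {x} x♭ (suc i) k       = iterate {x ∘ suc} (x♭ ∘ suc) i k

    iterateΓ : ∀ {δ} → IsΓFlat δ → ∀ i k → (δ (i ℕ.+ k) ^ (p ℕ.^ k)) ≈Γ δ i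
    iterateΓ     δ♭ zero    zero    = ≈⇒≈Γ (*-identityʳ _)
    iterateΓ {δ} δ♭ zero    (suc k) =
      ≈Γ-trans (≈⇒≈Γ (sym (^-assocʳ _ p (p ℕ.^ k))))
        (≈Γ-trans (≈Γ-^ (p ℕ.^ k) (δ♭ k)) (iterateΓ δ♭ zero k))
    iterateΓ {δ} δ♭ (suc i) k       = iterateΓ {δ ∘ suc} (δ♭ ∘ suc) i k

    flat⇒Γflat : ∀ {x} → IsFlat x → IsΓFlat x
    flat⇒Γflat x♭ i = ≈⇒≈Γ (x♭ i)

    ∣-descend : ∀ {δ ε} → IsΓFlat δ → IsΓFlat ε → ∀ {i j} → i ≤ j → δ j ∣ ε j → δ i ∣ ε i
    ∣-descend δ♭ ε♭ i≤j δj∣εj with ℕ.m≤n⇒∃[o]m+o≡n i≤j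
    ... | o , ≡.refl = ∣-respΓˡ (iterateΓ δ♭ _ o) (∣-respΓʳ (iterateΓ ε♭ _ o) (∣-^ (p ℕ.^ o) δj∣εj))

    ≉0-mono : .{{_ : NonZero p}} → ∀ {x} → IsFlat x → ∀ {i j} → i ≤ j → ¬ x i ≈ 0# → ¬ x j ≈ 0#
    ≉0-mono x♭ i≤j xi≉0 xj≈0 with ℕ.m≤n⇒∃[o]m+o≡n i≤j
    ... | o , ≡.refl = xi≉0 (trans (sym (iterate x♭ _ o))
                                   (trans (^-congˡ (p ℕ.^ o) xj≈0) (0^n≈0 (p ℕ.^ o) {{ℕ.m^n≢0 p o}})))

    square≉0 : 2 ≤ p → ∀ {x} → IsFlat x → ∀ {i j} → i < j → ¬ x i ≈ 0# → ¬ x j * x j ≈ 0#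
    square≉0 2≤p x♭ (s≤s i≤j) xi≉0 x²≈0 =
      ≉0-mono {{ℕ.>-nonZero (ℕ.<-trans (s≤s z≤n) 2≤p)}} x♭ i≤j xi≉0
        (trans (sym (x♭ _)) (square≈0⇒^≈0 p x²≈0 2≤p))

  module Perfection (em : ExcludedMiddle (c ⊔ ℓ)) (tvr : IsTVR)
                    {p : ℕ} (p-prime : Prime p) (char-p : fromℕ p ≈ 0#) where

    open Frobenius p-prime char-p
    open ValuationRing tvr
    open Sequences p
    open Flat p
    open IsTVR tvr

    private instance
      p≢0 : NonZero p
      p≢0 = prime⇒nonZero p-prime

    private
      emℓ : ExcludedMiddle ℓ
      emℓ {A} = map′ lower lift (em {Lift c A})

    2≤p : 2 ≤ p
    2≤p = ℕ.nonTrivial⇒n>1 p {{prime⇒nonTrivial p-prime}}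

    zero-or-nonzero : ∀ x → x ≈♭ 0♭ ⊎ ∃ λ i → ¬ x i ≈ 0#
    zero-or-nonzero x with emℓ {∃ λ i → ¬ x i ≈ 0#}
    ... | yes nonzero = inj₂ nonzero
    ... | no  ∄       = inj₁ λ i → decidable-stable emℓ (λ xi≉0 → ∄ (i , xi≉0))

    -- Lift the divisibility from coordinate i to i + j with ^-reflects-∣, then descend to j.
    ≤Γ♭-from-coordinate : ∀ {δ ε} → IsΓFlat δ → IsΓFlat ε →
                          ∀ {i} → ¬ δ i ≈ 0# → δ i ∣ ε i → δ ≤Γ♭ ε
    ≤Γ♭-from-coordinate δ♭ ε♭ {i} δi≉0 δi∣εi j = ∣-descend δ♭ ε♭ (ℕ.m≤n+m j i)
      (^-reflects-∣ (p ℕ.^ j) {{ℕ.m^n≢0 p j}} (x∣y∧y≉0⇒x≉0 (proj₁ (iterateΓ δ♭ i j)) δi≉0)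
        (∣-respΓˡ (≈Γ-sym (iterateΓ δ♭ i j)) (∣-respΓʳ (≈Γ-sym (iterateΓ ε♭ i j)) δi∣εi)))

    ≈Γ♭-from-coordinate : ∀ {δ ε} → IsΓFlat δ → IsΓFlat ε →
                          ∀ {i} → ¬ δ i ≈ 0# → δ i ≈Γ ε i → δ ≈Γ♭ ε
    ≈Γ♭-from-coordinate δ♭ ε♭ δi≉0 (δi∣εi , εi∣δi) j =
      ≤Γ♭-from-coordinate δ♭ ε♭ δi≉0 δi∣εi j ,
      ≤Γ♭-from-coordinate ε♭ δ♭ (x∣y∧y≉0⇒x≉0 εi∣δi δi≉0) εi∣δi j

    Γ♭-total : ∀ δ ε → IsΓFlat δ → IsΓFlat ε → δ ≤Γ♭ ε ⊎ ε ≤Γ♭ δ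
    Γ♭-total δ ε δ♭ ε♭ with zero-or-nonzero δ
    ... | inj₁ δ≈∞ = inj₂ (λ i → ∣-respʳ (sym (δ≈∞ i)) (x∣0 (ε i)))
    ... | inj₂ (i , δi≉0) with total (δ i) (ε i)
    ...   | inj₁ δi∣εi = inj₁ (≤Γ♭-from-coordinate δ♭ ε♭ δi≉0 δi∣εi)
    ...   | inj₂ εi∣δi = inj₂ (≤Γ♭-from-coordinate ε♭ δ♭ (x∣y∧y≉0⇒x≉0 εi∣δi δi≉0) εi∣δi)

    IsFlat-0 : IsFlat 0♭
    IsFlat-0 i = 0^n≈0 p

    IsFlat-1 : IsFlat 1♭
    IsFlat-1 i = 1^n≈1 p

    IsFlat-+ : ∀ {x y} → IsFlat x → IsFlat y → IsFlat (x +♭ y)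
    IsFlat-+ x♭ y♭ i = trans (frobenius-+ _ _) (+-cong (x♭ i) (y♭ i))

    IsFlat-* : ∀ {x y} → IsFlat x → IsFlat y → IsFlat (x *♭ y)
    IsFlat-* x♭ y♭ i = trans (^-distrib-* _ _ p) (*-cong (x♭ i) (y♭ i))

    IsFlat-‿ : ∀ {x} → IsFlat x → IsFlat (-♭ x)
    IsFlat-‿ x♭ i = trans (frobenius-‿ _) (-‿cong (x♭ i))

    IsFlat-^ : ∀ n {x} → IsFlat x → IsFlat (x ^♭ n)
    IsFlat-^ n x♭ i = trans (^-^-comm _ n p) (^-congˡ n (x♭ i))

    R♭-domain : ∀ {x y} → IsFlat x → IsFlat y → (x *♭ y) ≈♭ 0♭ → x ≈♭ 0♭ ⊎ y ≈♭ 0♭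
    R♭-domain {x} {y} x♭ y♭ xy≈0 with zero-or-nonzero x | zero-or-nonzero y
    ... | inj₁ x≈0 | _        = inj₁ x≈0
    ... | inj₂ _   | inj₁ y≈0 = inj₂ y≈0
    ... | inj₂ (i , xi≉0) | inj₂ (j , yj≉0) with *≈0⇒square≈0 (xy≈0 (suc (i ℕ.+ j)))
    ...   | inj₁ x²≈0 = contradiction x²≈0 (square≉0 2≤p x♭ (s≤s (ℕ.m≤m+n i j)) xi≉0)
    ...   | inj₂ y²≈0 = contradiction y²≈0 (square≉0 2≤p y♭ (s≤s (ℕ.m≤n+m j i)) yj≉0)

    quotient-square-coherent : ∀ {x y w : Seq} → IsFlat x → IsFlat y → (∀ i → x i * w i ≈ y i) →
      ∀ {i j} → i < j → ¬ x i ≈ 0# → (w (suc j) ^ p - w j) * (w (suc j) ^ p - w j) ≈ 0#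
    quotient-square-coherent {x} {y} {w} x♭ y♭ xw≈y {j = j} i<j xi≉0 =
      fromInj₂ (λ xj²≈0 → contradiction xj²≈0 (square≉0 2≤p x♭ i<j xi≉0)) (*≈0⇒square≈0 xj[w-w]≈0)
      where
      xj[w-w]≈0 : x j * (w (suc j) ^ p - w j) ≈ 0#
      xj[w-w]≈0 = begin
        x j * (w (suc j) ^ p - w j)                 ≈⟨ x[y-z]≈xy-xz (x j) _ _ ⟩
        x j * w (suc j) ^ p - x j * w j             ≈⟨ +-congʳ (*-congʳ (x♭ j)) ⟨
        x (suc j) ^ p * w (suc j) ^ p - x j * w j   ≈⟨ +-congʳ (^-distrib-* _ _ p) ⟨
        (x (suc j) * w (suc j)) ^ p - x j * w j
          ≈⟨ +-cong (trans (^-congˡ p (xw≈y (suc j))) (y♭ j)) (-‿cong (xw≈y j)) ⟩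
        y j - y j                                   ≈⟨ -‿inverseʳ (y j) ⟩
        0#                                          ∎

    -- The coordinatewise quotients w_i need not form an element of R^♭, but once x_{K-1} ≠ 0 their
    -- defects are square-zero, so the p^K-th powers z_i = w_{i+K}^{p^K} do.
    pointwise-∣⇒∣♭ : ∀ {x y} → IsFlat x → IsFlat y → (∀ i → x i ∣ y i) → x ∣♭ y
    pointwise-∣⇒∣♭ {x} {y} x♭ y♭ x∣y with zero-or-nonzero x
    ... | inj₁ x≈0 = 0♭ , IsFlat-0 , λ i → trans (zeroʳ (x i)) (sym (0∣x⇒x≈0 (∣-respˡ (x≈0 i) (x∣y i))))
    ... | inj₂ (i₀ , xi₀≉0) = z , z♭ , xz≈y
      where
      K : ℕ
      K = suc i₀
      q : ℕ
      q = p ℕ.^ K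
      w : Seq
      w i = proj₁ (x∣y i)
      z : Seq
      z i = w (i ℕ.+ K) ^ q
      z♭ : IsFlat z
      z♭ i = begin
        (w (suc i ℕ.+ K) ^ q) ^ p     ≈⟨ ^-^-comm _ q p ⟩
        (w (suc i ℕ.+ K) ^ p) ^ q
          ≈⟨ x∙y⁻¹≈ε⇒x≈y _ _ (trans (sym (frobenius-iterate-sub K _ _)) dᵠ≈0) ⟩
        w (i ℕ.+ K) ^ q               ∎
        where
        dᵠ≈0 : (w (suc i ℕ.+ K) ^ p - w (i ℕ.+ K)) ^ q ≈ 0#
        dᵠ≈0 = square≈0⇒^≈0 q
                 (quotient-square-coherent {w = w} x♭ y♭ (λ i → proj₂ (x∣y i)) (ℕ.m≤n+m K i) xi₀≉0)
                 (ℕ.≤-trans 2≤p (ℕ.m≤m*n p (p ℕ.^ i₀) {{ℕ.m^n≢0 p i₀}}))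
      xz≈y : ∀ i → x i * z i ≈ y i
      xz≈y i = begin
        x i * w (i ℕ.+ K) ^ q                 ≈⟨ *-congʳ (iterate x♭ i K) ⟨
        x (i ℕ.+ K) ^ q * w (i ℕ.+ K) ^ q     ≈⟨ ^-distrib-* _ _ q ⟨
        (x (i ℕ.+ K) * w (i ℕ.+ K)) ^ q       ≈⟨ ^-congˡ q (proj₂ (x∣y (i ℕ.+ K))) ⟩
        y (i ℕ.+ K) ^ q                       ≈⟨ iterate y♭ i K ⟩
        y i                                   ∎

  module Tilt (em : ExcludedMiddle (c ⊔ ℓ))
              {p : ℕ} (p-prime : Prime p) (ϖ : ℕ → Carrier) (T : IsTPERFϖ p ϖ) where

    open IsTPERFϖ T
    open IsTPERF tperf
    open ValuationRing tvr
    open Sequences p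
    open Flat p
    open Perfection em tvr p-prime charP

    private instance
      p≢0 : NonZero p
      p≢0 = prime⇒nonZero p-prime

    ϖ₁≉0 : ¬ ϖ 1 ≈ 0#
    ϖ₁≉0 = proj₁ ϖ₁-pu

    ϖ₁ᵖ≈0 : ϖ 1 ^ p ≈ 0#
    ϖ₁ᵖ≈0 = proj₁ (proj₂ ϖ₁-pu)

    xᵖ≈0⇒ϖ₁∣x : ∀ x → x ^ p ≈ 0# → ϖ 1 ∣ x
    xᵖ≈0⇒ϖ₁∣x = proj₂ (proj₂ ϖ₁-pu)

    ϖ♭-flat : IsFlat (ϖ♭ ϖ)
    ϖ♭-flat zero    = ϖ₁ᵖ≈0
    ϖ♭-flat (suc i) = ϖ-root i

    ϖ♭-nilpotent : ∀ i → ϖ♭ ϖ i ^ (p ℕ.^ i) ≈ 0#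
    ϖ♭-nilpotent = iterate ϖ♭-flat zero

    R♭-nontrivial : ¬ 1♭ ≈♭ 0♭
    R♭-nontrivial 1≈0 = ϖ₁≉0 (trans (sym (*-identityʳ _)) (trans (*-congˡ (1≈0 0)) (zeroʳ _)))

    part1 : Part1
    part1 = record
      { flat-0     = IsFlat-0
      ; flat-1     = IsFlat-1
      ; flat-+     = λ _ _ → IsFlat-+
      ; flat-*     = λ _ _ → IsFlat-*
      ; flat--     = λ _ → IsFlat-‿
      ; char♭      = λ _ → charP
      ; frob♭-surj = λ x x♭ → (λ i → x (suc i)) , (λ i → x♭ (suc i)) , x♭
      ; frob♭-inj  = λ x y x♭ y♭ xᵖ≈yᵖ i → trans (sym (x♭ i)) (trans (xᵖ≈yᵖ (suc i)) (y♭ i))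
      ; v♭-flat    = λ _ → flat⇒Γflat
      ; Γ♭-total   = Γ♭-total
      ; domain     = λ _ _ → R♭-domain
      ; nontriv    = R♭-nontrivial
      ; v♭-one     = λ _ → ≈Γ-refl
      ; v♭-∞       = λ _ _ → (λ v≈∞ i → ≈Γ∞⇒≈0 (v≈∞ i)) , (λ x≈0 i → ≈⇒≈Γ (x≈0 i))
      ; v♭-mul     = λ _ _ _ _ _ → ≈Γ-refl
      ; v♭-add     = v♭-add
      }
      where
      v♭-add : ∀ x y → IsFlat x → IsFlat y → v♭ x ≤Γ♭ v♭ (x +♭ y) ⊎ v♭ y ≤Γ♭ v♭ (x +♭ y)
      v♭-add x y x♭ y♭ with Γ♭-total (v♭ x) (v♭ y) (flat⇒Γflat x♭) (flat⇒Γflat y♭)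
      ... | inj₁ x≤y = inj₁ (λ i → ∣-+ ∣-refl (x≤y i))
      ... | inj₂ y≤x = inj₂ (λ i → ∣-+ (y≤x i) ∣-refl)

    roots : Carrier → Seq
    roots γ zero    = γ
    roots γ (suc i) = proj₁ (frobSurj (roots γ i))

    roots-flat : ∀ γ → IsFlat (roots γ)
    roots-flat γ i = proj₂ (frobSurj (roots γ i))

    -- Unlike a split on em itself, a split on this does not unfold ι.
    ∞-or-finite : ∀ γ → γ ≈Γ ∞Γ ⊎ ¬ γ ≈Γ ∞Γ
    ∞-or-finite γ = toSum em

    -- ∞ needs its own case: p-th roots of 0 need not vanish (ϖ 1 is one).
    ι : Γ → Seq
    ι γ with em {γ ≈Γ ∞Γ}
    ... | yes _ = 0♭
    ... | no  _ = roots γ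

    ι-flat : ∀ γ → IsFlat (ι γ)
    ι-flat γ with em {γ ≈Γ ∞Γ}
    ... | yes _ = IsFlat-0
    ... | no  _ = roots-flat γ

    ι-Γflat : ∀ γ → IsΓFlat (ι γ)
    ι-Γflat γ = flat⇒Γflat (ι-flat γ)

    ι-∞ : ∀ {γ} → γ ≈Γ ∞Γ → ι γ ≈♭ 0♭
    ι-∞ {γ} γ≈∞ with em {γ ≈Γ ∞Γ}
    ... | yes _   = λ _ → refl
    ... | no  γ≉∞ = contradiction γ≈∞ γ≉∞

    ι-root : ∀ γ i → (ι γ i ^ (p ℕ.^ i)) ≈Γ γ
    ι-root γ i with em {γ ≈Γ ∞Γ}
    ... | yes γ≈∞ = ≈Γ-trans (≈⇒≈Γ (0^n≈0 (p ℕ.^ i) {{ℕ.m^n≢0 p i}})) (≈Γ-sym γ≈∞)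
    ... | no  _   = ≈⇒≈Γ (iterate (roots-flat γ) zero i)

    ι-0 : ∀ γ → ι γ 0 ≈Γ γ
    ι-0 γ = ≈Γ-trans (≈⇒≈Γ (sym (*-identityʳ _))) (ι-root γ 0)

    ι0≉0 : ∀ {γ} → ¬ γ ≈Γ ∞Γ → ¬ ι γ 0 ≈ 0#
    ι0≉0 {γ} γ≉∞ = ≈Γ-≉0 (ι-0 γ) (≉Γ∞⇒≉0 γ≉∞)

    ι-resp : ∀ γ γ' → γ ≈Γ γ' → ι γ ≈Γ♭ ι γ'
    ι-resp γ γ' γ≈γ' with ∞-or-finite γ
    ... | inj₁ γ≈∞ = λ i → ≈⇒≈Γ (trans (ι-∞ γ≈∞ i) (sym (ι-∞ γ'≈∞ i)))
      where
      γ'≈∞ : γ' ≈Γ ∞Γ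
      γ'≈∞ = ≈Γ-trans (≈Γ-sym γ≈γ') γ≈∞
    ... | inj₂ γ≉∞ = ≈Γ♭-from-coordinate (ι-Γflat γ) (ι-Γflat γ') (ι0≉0 γ≉∞)
                      (≈Γ-trans (ι-0 γ) (≈Γ-trans γ≈γ' (≈Γ-sym (ι-0 γ'))))

    ι-strict : ∀ γ γ' → γ <Γ γ' → ι γ <Γ♭ ι γ'
    ι-strict γ γ' (γ∣γ' , γ≉γ') =
      ι≤ι , λ ι≈ι → γ≉γ' (≈Γ-trans (≈Γ-sym (ι-0 γ)) (≈Γ-trans (ι≈ι 0) (ι-0 γ')))
      where
      ι≤ι : ι γ ≤Γ♭ ι γ'
      ι≤ι with ∞-or-finite γ
      ... | inj₁ (_ , ∞∣γ) =
        contradiction (γ∣γ' , ∣-trans (∣-reflexive (0∣x⇒x≈0 (∣-trans ∞∣γ γ∣γ'))) ∞∣γ) γ≉γ'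
      ... | inj₂ γ≉∞ = ≤Γ♭-from-coordinate (ι-Γflat γ) (ι-Γflat γ') (ι0≉0 γ≉∞)
                         (∣-respΓˡ (≈Γ-sym (ι-0 γ)) (∣-respΓʳ (≈Γ-sym (ι-0 γ')) γ∣γ'))

    p·ϖ₁ : Seq
    p·ϖ₁ = p ·Γ♭ ι (ϖ 1)

    p·ϖ₁-Γflat : IsΓFlat p·ϖ₁
    p·ϖ₁-Γflat i = ≈Γ-^ p (ι-Γflat (ϖ 1) i)

    p·ϖ₁-0≈∞ : p·ϖ₁ 0 ≈Γ ∞Γ
    p·ϖ₁-0≈∞ = ≈Γ-trans (≈Γ-^ p (ι-0 (ϖ 1))) (≈⇒≈Γ ϖ₁ᵖ≈0)

    p·ϖ₁-1≈ϖ₁ : p·ϖ₁ 1 ≈Γ ϖ 1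
    p·ϖ₁-1≈ϖ₁ = ≈Γ-trans (ι-Γflat (ϖ 1) 0) (ι-0 (ϖ 1))

    ImageOfFinite : Seq → Set (c ⊔ ℓ)
    ImageOfFinite δ = Σ Γ (λ γ → ¬ (γ ≈Γ ∞Γ) × ι γ ≈Γ♭ δ)

    ι-image : ∀ δ → IsΓFlat δ → (δ <Γ♭ p·ϖ₁ → ImageOfFinite δ) × (ImageOfFinite δ → δ <Γ♭ p·ϖ₁)
    ι-image δ δ♭ = below⇒image , image⇒below
      where
      below⇒image : δ <Γ♭ p·ϖ₁ → ImageOfFinite δ
      below⇒image (δ≤p·ϖ₁ , δ≉p·ϖ₁) =
        δ 0 , δ₀≉∞ , ≈Γ♭-from-coordinate (ι-Γflat (δ 0)) δ♭ (ι0≉0 δ₀≉∞) (ι-0 (δ 0))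
        where
        δ₀≉∞ : ¬ δ 0 ≈Γ ∞Γ
        δ₀≉∞ δ₀≈∞ = δ≉p·ϖ₁ (λ i → δ≤p·ϖ₁ i , p·ϖ₁≤δ i)
          where
          p·ϖ₁≤δ : p·ϖ₁ ≤Γ♭ δ
          p·ϖ₁≤δ = ≤Γ♭-from-coordinate p·ϖ₁-Γflat δ♭ {1} (≈Γ-≉0 p·ϖ₁-1≈ϖ₁ ϖ₁≉0)
                  (∣-respΓˡ (≈Γ-sym p·ϖ₁-1≈ϖ₁) (xᵖ≈0⇒ϖ₁∣x (δ 1) (≈Γ∞⇒≈0 (≈Γ-trans (δ♭ 0) δ₀≈∞))))
      image⇒below : ImageOfFinite δ → δ <Γ♭ p·ϖ₁
      image⇒below (γ , γ≉∞ , ιγ≈δ) =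
        δ≤p·ϖ₁ , λ δ≈p·ϖ₁ → γ≉∞ (≈Γ-trans (≈Γ-sym δ₀≈γ) (≈Γ-trans (δ≈p·ϖ₁ 0) p·ϖ₁-0≈∞))
        where
        δ₀≈γ : δ 0 ≈Γ γ
        δ₀≈γ = ≈Γ-trans (≈Γ-sym (ιγ≈δ 0)) (ι-0 γ)
        δ≤p·ϖ₁ : δ ≤Γ♭ p·ϖ₁
        δ≤p·ϖ₁ = ≤Γ♭-from-coordinate δ♭ p·ϖ₁-Γflat {0} (≈Γ-≉0 δ₀≈γ (≉Γ∞⇒≉0 γ≉∞))
                (∣-trans (x∣0 (δ 0)) (proj₂ p·ϖ₁-0≈∞))

    part2 : Part2 ϖ ι
    part2 = record
      { root-unique = λ γ i δ δ' γ≉∞ δ≈γ δ'≈γ → ^-injectiveΓ (p ℕ.^ i) {{ℕ.m^n≢0 p i}}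
                        (≈Γ-≉0 δ≈γ (≉Γ∞⇒≉0 γ≉∞)) (≈Γ-trans δ≈γ (≈Γ-sym δ'≈γ))
      ; ι-root      = λ γ _ → ι-root γ
      ; ι-∞         = λ γ γ≈∞ i → ≈⇒≈Γ (ι-∞ γ≈∞ i)
      ; ι-flat      = ι-Γflat
      ; ι-resp      = ι-resp
      ; ι-strict    = ι-strict
      ; ι-image     = ι-image
      ; ϖ♭-flat     = ϖ♭-flat
      ; v♭-ϖ♭       = ≈Γ♭-from-coordinate (flat⇒Γflat ϖ♭-flat) p·ϖ₁-Γflat {1} ϖ₁≉0 (≈Γ-sym p·ϖ₁-1≈ϖ₁)
      }

    part3 : Part3 ϖ
    part3 = record
      { pr₀-surj = λ a → roots a , roots-flat a , refl
      ; pr₀-ker  = λ x x♭ → x₀≈0⇒ϖ♭∣x x♭ , ϖ♭∣x⇒x₀≈0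
      }
      where
      x₀≈0⇒ϖ♭∣x : ∀ {x} → IsFlat x → x 0 ≈ 0# → ϖ♭ ϖ ∣♭ x
      x₀≈0⇒ϖ♭∣x {x} x♭ x₀≈0 = pointwise-∣⇒∣♭ ϖ♭-flat x♭
        (≤Γ♭-from-coordinate (flat⇒Γflat ϖ♭-flat) (flat⇒Γflat x♭) {1} ϖ₁≉0
          (xᵖ≈0⇒ϖ₁∣x (x 1) (trans (x♭ 0) x₀≈0)))
      ϖ♭∣x⇒x₀≈0 : ∀ {x} → ϖ♭ ϖ ∣♭ x → x 0 ≈ 0#
      ϖ♭∣x⇒x₀≈0 (z , _ , ϖ♭z≈x) = trans (sym (ϖ♭z≈x 0)) (zeroˡ (z 0))

    R♭-complete : ∀ (s : ℕ → Seq) → (∀ n → IsFlat (s n)) → (∀ n → (ϖ♭ ϖ ^♭ n) ∣♭ (s (suc n) -♭ s n)) →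
                  Σ Seq (λ x → IsFlat x × (∀ n → (ϖ♭ ϖ ^♭ n) ∣♭ (x -♭ s n)))
    R♭-complete s s♭ s-cauchy = lim , lim♭ , lim-converges
      where
      module Coordinate (i : ℕ) = Cauchy {a = ϖ♭ ϖ i} {t = λ n → s n i}
        (λ n → proj₁ (s-cauchy n) i , proj₂ (proj₂ (s-cauchy n)) i)
      lim : Seq
      lim i = s (p ℕ.^ i) i
      stable : ∀ i {n} → p ℕ.^ i ≤ n → s n i ≈ lim i
      stable i = Coordinate.cauchy-stable i (ϖ♭-nilpotent i)
      lim♭ : IsFlat lim
      lim♭ i = trans (s♭ (p ℕ.^ suc i) i) (stable i (ℕ.m≤n*m (p ℕ.^ i) p))
      lim-converges : ∀ m → (ϖ♭ ϖ ^♭ m) ∣♭ (lim -♭ s m)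
      lim-converges m = pointwise-∣⇒∣♭ (IsFlat-^ m ϖ♭-flat) (IsFlat-+ lim♭ (IsFlat-‿ (s♭ m)))
        (λ i → ∣-respʳ (+-congʳ (stable i (ℕ.m≤m+n (p ℕ.^ i) m))) (Coordinate.cauchy-∣ i (p ℕ.^ i) m))

    part4 : Part4 ϖ
    part4 = record
      { domain    = λ _ _ → R♭-domain
      ; nontriv   = R♭-nontrivial
      ; val-ring  = val-ring
      ; separated = λ x _ ϖ♭ⁿ∣x i → let (z , _ , ϖ♭ᴺz≈x) = ϖ♭ⁿ∣x (p ℕ.^ i) in
                      trans (sym (ϖ♭ᴺz≈x i)) (trans (*-congʳ (ϖ♭-nilpotent i)) (zeroˡ (z i)))
      ; complete  = R♭-complete
      }
      where
      val-ring : ∀ x y → IsFlat x → IsFlat y → x ∣♭ y ⊎ y ∣♭ x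
      val-ring x y x♭ y♭ with Γ♭-total (v♭ x) (v♭ y) (flat⇒Γflat x♭) (flat⇒Γflat y♭)
      ... | inj₁ x≤y = inj₁ (pointwise-∣⇒∣♭ x♭ y♭ x≤y)
      ... | inj₂ y≤x = inj₂ (pointwise-∣⇒∣♭ y♭ x♭ y≤x)

proposition4p4 : ∀ {c ℓ} → ExcludedMiddle (c ⊔ ℓ) →
    (R : CommutativeRing c ℓ) (p : ℕ) → Prime p → (ϖ : ℕ → CommutativeRing.Carrier R) →
    TPerf.IsTPERFϖ R p ϖ →
    TPerf.Flat.Part1 R p
    × Σ (TPerf.Γ R → TPerf.Seq R) (λ ι → TPerf.Flat.Part2 R p ϖ ι)
    × TPerf.Flat.Part3 R p ϖ
    × TPerf.Flat.Part4 R p ϖ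
proposition4p4 em R p p-prime ϖ T = part1 , (ι , part2) , part3 , part4
  where open Tilt R em p-prime ϖ T
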